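{- Consider an instance of 2NC-TAP and run the greedy algorithm described in the context on it, producing weights $\mathrm{wgt}$ and the dual vector $y$ defined in the context. Then for every $u\in\mathrm{nonleaf}(T)$ and every partition $\mathcal{P}\in\Pi(u)$, $y_{\mathcal{P}}\ge 0$.
   Context: 2NC-TAP instance: a simple undirected graph $G=(V,E)$ that is 2-node connected (at least 3 nodes, connected, and remains connected after deleting any one node), nonnegative costs $\mathit{cost}\in\mathbb{R}_+^E$, and a spanning tree $T$ of $G$ all of whose edges have cost $0$. The edges of $E(G)\setminus E(T)$ are called links; $L(G)$ is the set of links. $\mathrm{nonleaf}(T)$ is the set of non-leaf nodes of $T$. For $u\in\mathrm{nonleaf}(T)$, $\pi(\mathrm{comps}(T-u))$ is the partition of $V\setminus\{u\}$ into the node sets of the connected components of $T-u$, $\nu(u)$ is its number of parts, and $\Pi(u)$ is the set of partitions of $V\setminus\{u\}$ of which $\pi(\mathrm{comps}(T-u))$ is a refinement. A link $\ell$ crosses a partition $\mathcal{P}$ of $V\setminus\{u\}$ if both end nodes of $\ell$ lie in $V\setminus\{u\}$ and in different parts of $\mathcal{P}$. Greedy algorithm: start with $F=\emptyset$ and $\mathrm{wgt}(\mathcal{P})=0$ for every $\mathcal{P}\in\bigcup_{u}\Pi(u)$. In iteration $i=1,2,\dots$, let $F^i$ be the set of links picked so far; for each $u\in\mathrm{nonleaf}(T)$ let $\mathcal{P}^i_u\in\Pi(u)$ be the partition of $V\setminus\{u\}$ into node sets of the connected components of $(T\cup F^i)-u$; for each link $\ell$ let $\mathrm{inc}^i(\ell)=\{\mathcal{P}^i_u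 : u\in\mathrm{nonleaf}(T),\ \ell \text{ crosses } \mathcal{P}^i_u\}$. The iteration picks a link $\ell^*$ with $\mathrm{inc}^i(\ell^*)\ne\emptyset$ minimizing $\mathit{cost}(\ell^*)/|\mathrm{inc}^i(\ell^*)|$, sets $\mathrm{wgt}(\mathcal{P}^i_u)=\mathit{cost}(\ell^*)/|\mathrm{inc}^i(\ell^*)|$ for every $\mathcal{P}^i_u\in\mathrm{inc}^i(\ell^*)$, and sets $F^{i+1}=F^i\cup\{\ell^*\}$. The algorithm stops when $T\cup F$ is a 2-node connected spanning subgraph of $G$. Dual vector: for each $u\in\mathrm{nonleaf}(T)$, let $\mathcal{P}^{(1)}_u,\dots,\mathcal{P}^{(\nu(u)-1)}_u$ be the partitions of $\Pi(u)$ that are assigned a weight during the run, in the order in which they are assigned. Define $y(\mathcal{P}^{(1)}_u)=\mathrm{wgt}(\mathcal{P}^{(1)}_u)$, $y(\mathcal{P}^{(j)}_u)=\mathrm{wgt}(\mathcal{P}^{(j)}_u)-\mathrm{wgt}(\mathcal{P}^{(j-1)}_u)$ for $j=2,\dots,\nu(u)-1$, and $y(\mathcal{P})=0$ for all other $\mathcal{P}\in\Pi(u)$.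
   Formalization: The costs are nonnegative rationals rather than nonnegative reals. -}

module Defs where

open import Level using (0ℓ)
open import Data.Nat as ℕ using (ℕ; zero; suc)
open import Data.Integer using (+_)
open import Data.Rational using (ℚ; 0ℚ; _*_; _-_; _/_; _≤_)
open import Data.Fin as Fin using (Fin; toℕ)
open import Data.Product using (Σ; _×_; _,_; proj₁; proj₂; swap)
open import Data.Sum using (_⊎_)
open import Data.Unit using (⊤)
open import Data.List using (List; []; _∷_; _++_; length)
open import Data.List.Membership.Propositional using (_∈_; _∉_)
open import Data.List.Relation.Unary.Unique.Propositional using (Unique)
open import Relation.Binary.PropositionalEquality using (_≡_; _≢_)
open import Relation.Binary.Construct.Closure.ReflexiveTransitive using (Star)
open import Relation.Nullary using (¬_)
open import Function.Bundles using (_⇔_)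

-- Graphs on the node set Fin n, given by a (symmetric) adjacency relation

Rel : ℕ → Set₁
Rel n = Fin n → Fin n → Set

module _ {n : ℕ} where

  ListAdj : List (Fin n × Fin n) → Rel n
  ListAdj es a b = ((a , b) ∈ es) ⊎ ((b , a) ∈ es)

  Without : Rel n → Fin n → Rel n
  Without Adj u a b = a ≢ u × b ≢ u × Adj a b

  Connected : Rel n → Set
  Connected Adj = ∀ x y → Star Adj x y

  ConnectedWithout : Rel n → Fin n → Set
  ConnectedWithout Adj u = ∀ x y → x ≢ u → y ≢ u → Star (Without Adj u) x y

  TwoNC : Rel n → Set
  TwoNC Adj = (3 ℕ.≤ n) × Connected Adj × (∀ u → ConnectedWithout Adj u)

  Walk : Rel n → List (Fin n) → Set
  Walk Adj [] = ⊤
  Walk Adj (x ∷ []) = ⊤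
  Walk Adj (x ∷ y ∷ r) = Adj x y × Walk Adj (y ∷ r)

  IsCycle : Rel n → Fin n → List (Fin n) → Set
  IsCycle Adj x vs = (2 ℕ.≤ length vs) × Unique (x ∷ vs) × Walk Adj (x ∷ vs ++ x ∷ [])

  Acyclic : Rel n → Set
  Acyclic Adj = ∀ x vs → ¬ IsCycle Adj x vs

  IsTree : Rel n → Set
  IsTree Adj = Connected Adj × Acyclic Adj

  NonLeaf : Rel n → Fin n → Set
  NonLeaf Adj u = Σ (Fin n) λ a → Σ (Fin n) λ b → a ≢ b × Adj u a × Adj u b

  HasCard : (Fin n → Set) → ℕ → Set
  HasCard P c = Σ (List (Fin n)) λ xs →
    Unique xs × length xs ≡ c × (∀ x → P x ⇔ (x ∈ xs))

  -- Partitions of V \ {u}, represented by their "same part" relation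

  IsPartitionOf : Fin n → Rel n → Set
  IsPartitionOf u R =
      (∀ x y → R x y → x ≢ u × y ≢ u)
    × (∀ x → x ≢ u → R x x)
    × (∀ x y → R x y → R y x)
    × (∀ x y z → R x y → R y z → R x z)

  _≐_ : Rel n → Rel n → Set
  R ≐ S = ∀ x y → R x y ⇔ S x y

  Comps : Rel n → Fin n → Rel n
  Comps Adj u x y = x ≢ u × y ≢ u × Star (Without Adj u) x y

  InΠ : Rel n → Fin n → Rel n → Set
  InΠ TAdj u R = IsPartitionOf u R × (∀ x y → Comps TAdj u x y → R x y)

  Crosses : Fin n → Fin n × Fin n → Rel n → Set
  Crosses u (a , b) R = a ≢ u × b ≢ u × ¬ R a b

ratio : ℚ → ℕ → ℚ
ratio q zero = 0ℚ
ratio q (suc c) = q * (+ 1 / suc c)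

-- 2NC-TAP instance.  G = T ∪ links; tree edges have cost 0 (not stored).

record Instance (n : ℕ) : Set₁ where
  field
    treeEdges : List (Fin n × Fin n)
    m         : ℕ
    link      : Fin m → Fin n × Fin n
    cost      : Fin m → ℚ
    tree-noloop  : ∀ a b → (a , b) ∈ treeEdges → a ≢ b
    tree-unique  : Unique treeEdges
    tree-noanti  : ∀ a b → (a , b) ∈ treeEdges → (b , a) ∉ treeEdges
    link-noloop  : ∀ l → proj₁ (link l) ≢ proj₂ (link l)
    link-inj     : ∀ l l' → (link l ≡ link l') ⊎ (link l ≡ swap (link l')) → l ≡ l'
    link-nottree : ∀ l → (link l ∉ treeEdges) × (swap (link l) ∉ treeEdges)
    cost-nonneg  : ∀ l → 0ℚ ≤ cost l

  TAdj : Rel n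
  TAdj = ListAdj treeEdges

  LAdj : Fin m → Rel n
  LAdj l a b = (link l ≡ (a , b)) ⊎ (link l ≡ (b , a))

  GAdj : Rel n
  GAdj a b = TAdj a b ⊎ Σ (Fin m) λ l → LAdj l a b

  field
    G-2NC  : TwoNC GAdj
    T-tree : IsTree TAdj

-- A run of the greedy algorithm: picks run 0, run 1, ..., run (k-1)

module _ {n : ℕ} (I : Instance n) where
  open Instance I

  module Greedy (k : ℕ) (run : Fin k → Fin m) where

    HAdj : ℕ → Rel n
    HAdj i a b = TAdj a b ⊎ Σ (Fin k) λ j → (toℕ j ℕ.< i) × LAdj (run j) a b

    Part : ℕ → Fin n → Rel n
    Part i u = Comps (HAdj i) u

    -- u such that P^i_u ∈ inc^i(l)  (distinct u give distinct partitions)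
    Inc : ℕ → Fin m → Fin n → Set
    Inc i l u = NonLeaf TAdj u × Crosses u (link l) (Part i u)

    record IsGreedyRun : Set where
      field
        notDone   : ∀ (i : Fin k) → ¬ TwoNC (HAdj (toℕ i))
        done      : TwoNC (HAdj k)
        incNonEmpty : ∀ (i : Fin k) → Σ ℕ λ c → HasCard (Inc (toℕ i) (run i)) c × 1 ℕ.≤ c
        minimal   : ∀ (i : Fin k) (l : Fin m) (c c' : ℕ) →
                    HasCard (Inc (toℕ i) (run i)) c → HasCard (Inc (toℕ i) l) c' → 1 ℕ.≤ c' →
                    ratio (cost (run i)) c ≤ ratio (cost l) c'

    -- iteration i assigns a weight to P^i_u
    Event : Fin n → Fin k → Set
    Event u i = Inc (toℕ i) (run i) u

    Val : Fin k → ℚ → Set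
    Val i w = Σ ℕ λ c → HasCard (Inc (toℕ i) (run i)) c × (w ≡ ratio (cost (run i)) c)

    Y : Fin n → Rel n → ℚ → Set
    Y u R q =
        (Σ (Fin k) λ i → Event u i × (R ≐ Part (toℕ i) u)
            × (∀ (i' : Fin k) → toℕ i' ℕ.< toℕ i → ¬ Event u i')
            × Val i q)
      ⊎
        (Σ (Fin k) λ i → Σ (Fin k) λ i' → toℕ i' ℕ.< toℕ i
            × Event u i × Event u i' × (R ≐ Part (toℕ i) u)
            × (∀ (i'' : Fin k) → toℕ i' ℕ.< toℕ i'' → toℕ i'' ℕ.< toℕ i → ¬ Event u i'')
            × Σ ℚ λ w → Σ ℚ λ w' → Val i w × Val i' w' × (q ≡ w - w'))
      ⊎
        ((∀ (i : Fin k) → Event u i → ¬ (R ≐ Part (toℕ i) u)) × (q ≡ 0ℚ))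

{-# OPTIONS --safe #-}
module Submission where

-- The weights assigned by the greedy algorithm never decrease.  If link ℓ is
-- picked at iteration i with |inc^i(ℓ)| = c ≥ 1, then at any earlier iteration
-- i' every P^{i'}_v refines P^i_v, so ℓ crossed at least c of them, and the
-- greedy choice at i' had ratio at most cost ℓ / |inc^{i'}(ℓ)| ≤ cost ℓ / c.
-- Each y(P) is either a weight or a later weight minus an earlier one.
--
-- Crossing a partition is not decidable here, so |inc^{i'}(ℓ)| exists only
-- under ¬¬; this suffices because _≤_ on ℚ is decidable, hence ¬¬-stable.

open import Defs
open import Data.Nat using (ℕ)
open import Data.Fin using (Fin)
open import Data.Rational using (ℚ; 0ℚ; _≤_)

open import Level using (0ℓ)
import Data.Nat as ℕ
import Data.Nat.Properties as ℕ
import Data.Integer as ℤ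
import Data.Integer.Properties as ℤ
open import Data.Rational using (_*_; _-_; -_; _/_; *≤*; NonNegative; nonNegative)
open import Data.Rational.Properties
  using (≤-refl; ≤-trans; _≤?_; *-zeroˡ; *-monoʳ-≤-nonNeg; *-monoˡ-≤-nonNeg;
         +-inverseʳ; +-monoˡ-≤; normalize-nonNeg; normalize-coprime)
open import Data.Nat.Coprimality using (1-coprimeTo)
open import Data.Fin using (zero; suc; toℕ; _≟_)
open import Data.Product using (∃; _,_; proj₂)
open import Data.Sum using (inj₁; inj₂)
open import Data.List using (List; length; filter; allFin)
open import Data.List.Properties using (length-filter)
open import Data.List.Membership.Propositional using (_∈_)
open import Data.List.Membership.Propositional.Properties
  using (∈-filter⁺; ∈-filter⁻; ∈-allFin)
open import Data.List.Membership.Propositional.Properties.WithK using (unique∧set⇒bag)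
import Data.List.Membership.DecPropositional as DecMembership
open import Data.List.Relation.Unary.Unique.Propositional using (Unique)
import Data.List.Relation.Unary.Unique.Propositional.Properties as Unique
open import Data.List.Relation.Binary.BagAndSetEquality using (∼bag⇒↭)
open import Data.List.Relation.Binary.Permutation.Propositional.Properties using (↭-length)
open import Relation.Binary.Definitions using (DecidableEquality)
open import Relation.Binary.PropositionalEquality using (_≡_; refl; subst; subst₂; sym)
open import Relation.Binary.Construct.Closure.ReflexiveTransitive as Star using ()
open import Relation.Nullary using (¬_)
open import Relation.Nullary.Decidable using (¬¬-excluded-middle; decidable-stable)
open import Relation.Nullary.Negation using (¬¬-map)
open import Relation.Unary using (Pred; Decidable; _⊆_)
open import Function.Bundles using (mk⇔; Equivalence)

unique-⊆⇒length-≤ : ∀ {A : Set} → DecidableEquality A → {xs ys : List A} →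
  Unique xs → Unique ys → (∀ {x} → x ∈ xs → x ∈ ys) → length xs ℕ.≤ length ys
unique-⊆⇒length-≤ _≟_ {xs} {ys} xs! ys! xs⊆ys =
  ℕ.≤-trans (ℕ.≤-reflexive |xs|≡|ys∩xs|) (length-filter (_∈? xs) ys)
  where
  open DecMembership _≟_ using (_∈?_)
  |xs|≡|ys∩xs| : length xs ≡ length (filter (_∈? xs) ys)
  |xs|≡|ys∩xs| = ↭-length (∼bag⇒↭ (unique∧set⇒bag xs! (Unique.filter⁺ (_∈? xs) ys!)
    (mk⇔ (λ x∈xs → ∈-filter⁺ (_∈? xs) (xs⊆ys x∈xs) x∈xs)
         (λ x∈ys∩xs → proj₂ (∈-filter⁻ (_∈? xs) {xs = ys} x∈ys∩xs)))))

¬¬-decidable : ∀ n (P : Pred (Fin n) 0ℓ) → ¬ ¬ Decidable P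
¬¬-decidable ℕ.zero    P ¬dec = ¬dec (λ ())
¬¬-decidable (ℕ.suc n) P ¬dec = ¬¬-excluded-middle λ P0? →
  ¬¬-decidable n (λ x → P (suc x)) λ Psuc? →
    ¬dec λ { zero → P0? ; (suc x) → Psuc? x }

module _ {n : ℕ} where

  hasCard-decidable : {P : Pred (Fin n) 0ℓ} → Decidable P → ∃ (HasCard P)
  hasCard-decidable {P} P? =
    length xs , xs , Unique.filter⁺ P? (Unique.allFin⁺ n) , refl ,
    λ x → mk⇔ (∈-filter⁺ P? (∈-allFin x)) (λ x∈xs → proj₂ (∈-filter⁻ P? {xs = allFin n} x∈xs))
    where xs = filter P? (allFin n)

  hasCard-mono : {P Q : Pred (Fin n) 0ℓ} {c d : ℕ} →
    P ⊆ Q → HasCard P c → HasCard Q d → c ℕ.≤ d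
  hasCard-mono P⊆Q (xs , xs! , refl , P⇔xs) (ys , ys! , refl , Q⇔ys) =
    unique-⊆⇒length-≤ _≟_ xs! ys! λ {x} x∈xs →
      Equivalence.to (Q⇔ys x) (P⊆Q (Equivalence.from (P⇔xs x) x∈xs))

ratio-nonNeg : ∀ {q} c → 0ℚ ≤ q → 0ℚ ≤ ratio q c
ratio-nonNeg ℕ.zero    0≤q = ≤-refl
ratio-nonNeg {q} (ℕ.suc c) 0≤q =
  subst (_≤ q * 1/c+1) (*-zeroˡ 1/c+1) (*-monoʳ-≤-nonNeg 1/c+1 0≤q)
  where
  1/c+1 = ℤ.+ 1 / ℕ.suc c
  instance
    _ : NonNegative 1/c+1
    _ = normalize-nonNeg 1 (ℕ.suc c)

1/suc-antimono-≤ : ∀ {c d} → c ℕ.≤ d → ℤ.+ 1 / ℕ.suc d ≤ ℤ.+ 1 / ℕ.suc c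
1/suc-antimono-≤ {c} {d} c≤d
  rewrite normalize-coprime {1} {c} (1-coprimeTo (ℕ.suc c))
        | normalize-coprime {1} {d} (1-coprimeTo (ℕ.suc d)) =
  *≤* (subst₂ ℤ._≤_ (sym (ℤ.*-identityˡ _)) (sym (ℤ.*-identityˡ _))
                   (ℤ.+≤+ (ℕ.s≤s c≤d)))

ratio-antimono : ∀ {q c d} → 0ℚ ≤ q → 1 ℕ.≤ c → c ℕ.≤ d → ratio q d ≤ ratio q c
ratio-antimono {q} {ℕ.suc c} {ℕ.suc d} 0≤q _ (ℕ.s≤s c≤d) =
  *-monoˡ-≤-nonNeg q (1/suc-antimono-≤ c≤d)
  where
  instance
    _ : NonNegative q
    _ = nonNegative 0≤q

p≤q⇒0≤q-p : ∀ {p q} → p ≤ q → 0ℚ ≤ q - p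
p≤q⇒0≤q-p {p} {q} p≤q = subst (_≤ q - p) (+-inverseʳ p) (+-monoˡ-≤ (- p) p≤q)

module GreedyRun {n : ℕ} (I : Instance n) (k : ℕ) (run : Fin k → Fin (Instance.m I)) where
  open Instance I
  open Greedy I k run

  HAdj-mono : ∀ {i j} → i ℕ.≤ j → ∀ {a b} → HAdj i a b → HAdj j a b
  HAdj-mono i≤j (inj₁ tree)               = inj₁ tree
  HAdj-mono i≤j (inj₂ (l , l<i , l-joins)) = inj₂ (l , ℕ.<-≤-trans l<i i≤j , l-joins)

  Part-mono : ∀ {i j} → i ℕ.≤ j → ∀ {u x y} → Part i u x y → Part j u x y
  Part-mono i≤j (x≢u , y≢u , path) =
    x≢u , y≢u , Star.map (λ (a≢u , b≢u , edge) → a≢u , b≢u , HAdj-mono i≤j edge) path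

  Inc-antimono : ∀ {i j} → i ℕ.≤ j → ∀ {l} → Inc j l ⊆ Inc i l
  Inc-antimono i≤j (nonLeaf , a≢u , b≢u , ¬same) =
    nonLeaf , a≢u , b≢u , λ same → ¬same (Part-mono i≤j same)

  Val-mono : IsGreedyRun → ∀ {i i' w w'} → toℕ i' ℕ.≤ toℕ i → Val i' w' → Val i w → w' ≤ w
  Val-mono greedy {i} {i'} i'≤i (c' , |inc'| , refl) (c , |inc| , refl) =
    decidable-stable (_ ≤? _) (¬¬-map viaCard (¬¬-decidable n (Inc (toℕ i') (run i))))
    where
    open IsGreedyRun greedy
    1≤c : 1 ℕ.≤ c
    1≤c with incNonEmpty i
    ... | c₀ , |inc|₀ , 1≤c₀ = ℕ.≤-trans 1≤c₀ (hasCard-mono (λ inc → inc) |inc|₀ |inc|)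
    viaCard : Decidable (Inc (toℕ i') (run i)) → ratio (cost (run i')) c' ≤ ratio (cost (run i)) c
    viaCard inc? with hasCard-decidable inc?
    ... | d , |earlierInc| =
      ≤-trans (minimal i' (run i) c' d |inc'| |earlierInc| (ℕ.≤-trans 1≤c c≤d))
              (ratio-antimono (cost-nonneg (run i)) 1≤c c≤d)
      where
      c≤d : c ℕ.≤ d
      c≤d = hasCard-mono (Inc-antimono i'≤i) |inc| |earlierInc|

  Y-nonNeg : IsGreedyRun → ∀ u R q → Y u R q → 0ℚ ≤ q
  Y-nonNeg greedy u R q (inj₁ (i , _ , _ , _ , c , _ , refl)) =
    ratio-nonNeg c (cost-nonneg (run i))
  Y-nonNeg greedy u R q (inj₂ (inj₁ (_ , _ , i'<i , _ , _ , _ , _ , _ , _ , val , val' , refl))) =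
    p≤q⇒0≤q-p (Val-mono greedy (ℕ.<⇒≤ i'<i) val' val)
  Y-nonNeg greedy u R q (inj₂ (inj₂ (_ , refl))) = ≤-refl

lemma3p2 : ∀ {n : ℕ} (I : Instance n) (k : ℕ) (run : Fin k → Fin (Instance.m I)) →
    Greedy.IsGreedyRun I k run →
    ∀ (u : Fin n) → NonLeaf (Instance.TAdj I) u →
    ∀ (R : Rel n) → InΠ (Instance.TAdj I) u R →
    ∀ (q : ℚ) → Greedy.Y I k run u R q → 0ℚ ≤ q
lemma3p2 I k run greedy u _ R _ q y = GreedyRun.Y-nonNeg I k run greedy u R q y
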